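{- For every $D\in\mathcal D_{n,m,\sigma}$, the pair $r(D)=(O,I)$ belongs to $\mathcal R_{n,m,\sigma}$.
   Context: For a positive integer $k$, $[k]=\{1,\dots,k\}$. A DFA is a triple $D=(Q,\Sigma,\delta)$ with $Q=[n]$, source state $1$, alphabet $\Sigma=[\sigma]$ ordered as integers, and partial transition function $\delta:Q\times\Sigma\to Q$; $m$ is the number of pairs on which $\delta$ is defined. DFAs are assumed to satisfy: state $v$ has an incoming transition iff $v>1$. A WDFA (w.r.t. order $1<\dots<n$) satisfies: (i) if $u'=\delta(u,a)$, $v'=\delta(v,a')$ and $a<a'$ then $u'<v'$; (ii) if $u'=\delta(u,a)\ne\delta(v,a)=v'$ and $u<v$ then $u'<v'$. $\mathcal D_{n,m,\sigma}$ is the set of WDFAs with states $[n]$, $m$ transitions, effective alphabet $[\sigma]$ (every letter labels some transition), and Wheeler order $1<\dots<n$. Standing assumptions: $n-1\le m\le n\sigma$, $\sigma\le n-1$. For a 0/1 vector $x$, $\|x\|$ is its number of ones; for a 0/1 matrix $A$, $A_j$ is its $j$-th column and $\|A\|$ its number of ones. Let $\mathcal O_{n,\sigma,m}=\{O\in\{0,1\}^{n\times\sigma}:\|O\|=m,\ \|O_j\|\ge1\ \forall j\in[\sigma]\}$, $\mathcal I_{m,n}=\{I\in\{0,1\}^m:\|I\|=n-1\}$, for $O\in\mathcal O_{n,\sigma,m}$ let $\mathcal I_O=\{I\in\mathcal I_{m,n}: I_{1+\sum_{k=1}^{j-1}\|O_k\|}=1\ \forall j\in[\sigma]\}$, and $\mathcal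 R_{n,m,\sigma}=\{(O,I):O\in\mathcal O_{n,\sigma,m},\ I\in\mathcal I_O\}$. For $D\in\mathcal D_{n,m,\sigma}$, $r(D)=(O,I)$ where $O_{u,j}=1$ iff $\delta(u,j)$ is defined, and $I$ is the concatenation over $v=2,3,\dots,n$ (in this order) of a single $1$ followed by $|\delta^{in}(v)|-1$ zeros, where $\delta^{in}(v)=\{u\in Q:\exists j,\ \delta(u,j)=v\}$. -}

module Defs where

open import Data.Nat using (ℕ; zero; suc; _+_; _∸_; _≤_; _<_; _<ᵇ_)
open import Data.Bool using (Bool; true; false; if_then_else_; _∨_)
open import Data.Fin using (Fin; toℕ; _≟_) renaming (zero to fzero; suc to fsuc; _<_ to _<ᶠ_)
open import Data.Maybe using (Maybe; just; nothing; is-just)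
open import Data.List using (List; []; _∷_; _++_; replicate; length; concatMap; filterᵇ; allFin)
open import Data.Product using (_×_; _,_; Σ; ∃)
open import Relation.Binary.PropositionalEquality using (_≡_; _≢_)
open import Relation.Nullary.Decidable using (⌊_⌋)

-- States Q = [n] are represented by Fin n (Fin index i stands for state i+1,
-- so the source state 1 is fzero).  Letters [σ] are Fin σ (index j stands
-- for letter j+1), ordered as integers.
Trans : ℕ → ℕ → Set
Trans n σ = Fin n → Fin σ → Maybe (Fin n)

countF : ∀ {k} → (Fin k → Bool) → ℕ
countF {zero}  f = 0
countF {suc k} f = (if f fzero then 1 else 0) + countF (λ i → f (fsuc i))

anyF : ∀ {k} → (Fin k → Bool) → Bool
anyF {zero}  f = false
anyF {suc k} f = f fzero ∨ anyF (λ i → f (fsuc i))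

sumF : ∀ {k} → (Fin k → ℕ) → ℕ
sumF {zero}  f = 0
sumF {suc k} f = f fzero + sumF (λ i → f (fsuc i))

Matrix : ℕ → ℕ → Set
Matrix n σ = Fin n → Fin σ → Bool

colNorm : ∀ {n σ} → Matrix n σ → Fin σ → ℕ
colNorm A j = countF (λ u → A u j)

matNorm : ∀ {n σ} → Matrix n σ → ℕ
matNorm {σ = σ} A = sumF (λ j → colNorm A j)

ones : List Bool → ℕ
ones [] = 0
ones (true ∷ xs) = suc (ones xs)
ones (false ∷ xs) = ones xs

nth : ∀ {A : Set} → List A → ℕ → Maybe A
nth [] _ = nothing
nth (x ∷ xs) zero = just x
nth (x ∷ xs) (suc i) = nth xs i

colsBefore : ∀ {n σ} → Matrix n σ → Fin σ → ℕ
colsBefore O j = sumF (λ k → if toℕ k <ᵇ toℕ j then colNorm O k else 0)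

numTrans : ∀ {n σ} → Trans n σ → ℕ
numTrans {n} {σ} δ = sumF (λ (u : Fin n) → countF (λ (a : Fin σ) → is-just (δ u a)))

record IsWDFA (n m σ : ℕ) (δ : Trans n σ) : Set where
  field
    incoming     : ∀ (v : Fin n) → (0 < toℕ v → ∃ λ u → ∃ λ a → δ u a ≡ just v)
                                  × (toℕ v ≡ 0 → ∀ u a → δ u a ≢ just v)
    wheeler-i    : ∀ (u v u' v' : Fin n) (a a' : Fin σ) →
                   δ u a ≡ just u' → δ v a' ≡ just v' → a <ᶠ a' → u' <ᶠ v'
    wheeler-ii   : ∀ (u v u' v' : Fin n) (a : Fin σ) →
                   δ u a ≡ just u' → δ v a ≡ just v' → u' ≢ v' → u <ᶠ v → u' <ᶠ v'
    transitions  : numTrans δ ≡ m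
    effective    : ∀ (a : Fin σ) → ∃ λ u → ∃ λ v → δ u a ≡ just v

rO : ∀ {n σ} → Trans n σ → Matrix n σ
rO δ u j = is-just (δ u j)

eqMaybe : ∀ {n} → Maybe (Fin n) → Fin n → Bool
eqMaybe nothing  v = false
eqMaybe (just x) v = ⌊ x ≟ v ⌋

inDeg : ∀ {n σ} → Trans n σ → Fin n → ℕ
inDeg δ v = countF (λ u → anyF (λ j → eqMaybe (δ u j) v))

rI : ∀ {n σ} → Trans n σ → List Bool
rI {n} δ = concatMap (λ v → true ∷ replicate (inDeg δ v ∸ 1) false)
                     (filterᵇ (λ v → 0 <ᵇ toℕ v) (allFin n))

InO : (n σ m : ℕ) → Matrix n σ → Set
InO n σ m O = matNorm O ≡ m × (∀ j → 1 ≤ colNorm O j)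

InIm : ℕ → ℕ → List Bool → Set
InIm m n I = length I ≡ m × ones I ≡ n ∸ 1

InIO : ∀ {n σ} → ℕ → Matrix n σ → List Bool → Set
InIO {n} m O I = InIm m n I × (∀ j → nth I (colsBefore O j) ≡ just true)

InR : (n m σ : ℕ) → Matrix n σ → List Bool → Set
InR n m σ O I = InO n σ m O × InIO {n} {σ} m O I

-- Count transitions rather than states.  By Wheeler axiom (i) no state has two
-- transitions with different labels into the same state, so |δ^in(v)| is the number of
-- transitions entering v, and both ‖O‖ and |I| equal the number m of transitions.  For a
-- letter j let v₀ be the smallest target of a j-transition; by axiom (i) and minimality
-- of v₀, a transition has label < j iff its target is < v₀.  Hence Σ_{k<j} ‖O_k‖ counts
-- the transitions entering states before v₀, which is the offset in I of the block of
-- v₀, and that block starts with a 1.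
module Submission where

open import Defs
open import Data.Nat using (ℕ; zero; suc; _+_; _*_; _∸_; _≤_; _<_; _<ᵇ_; z≤n; s≤s)
open import Data.Nat.Properties using (+-0-commutativeMonoid; +-identityʳ; _<?_; <-irrefl; <-trans; m+[n∸m]≡n)
open import Data.Bool using (Bool; true; false; if_then_else_; T)
open import Data.Bool.Properties using (if-eta; ¬-not)
open import Data.Unit using (tt)
open import Data.Empty using (⊥-elim)
open import Data.Fin using (Fin; toℕ; _≟_; inject; fromℕ<) renaming (zero to fzero; suc to fsuc; _<_ to _<ᶠ_)
open import Data.Fin.Properties using (¬∀⟶∃¬-smallest; any?; <-cmp; 0≢1+n; suc-injective; toℕ-injective; toℕ-inject; toℕ-fromℕ<)
open import Data.Maybe using (Maybe; just; nothing; is-just; maybe′)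
open import Data.Maybe.Properties using (≡-dec)
open import Data.List using (List; []; _∷_; _++_; replicate; length; concat; concatMap; filterᵇ; tabulate)
open import Data.List.Properties using (length-++; length-replicate)
open import Data.Product using (_×_; _,_; ∃; proj₁; proj₂)
open import Function using (id; _∘_; _⇔_; mk⇔)
open import Relation.Binary.PropositionalEquality using (_≡_; refl; sym; trans; cong; cong₂; subst; module ≡-Reasoning)
open import Relation.Binary.Definitions using (tri<; tri≈; tri>)
open import Relation.Nullary using (¬_; ¬?; yes; no)
open import Relation.Nullary.Decidable using (toWitness; ⌊⌋-map′; does-⇔; decidable-stable)
open import Relation.Unary using (Pred; Decidable)
open import Algebra.Properties.CommutativeMonoid.Sum +-0-commutativeMonoid
  using (sum; sum-syntax; ∑-comm; sum-cong-≗; sum-replicate-zero)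

𝟙 : Bool → ℕ
𝟙 b = if b then 1 else 0

sumF≡sum : ∀ {k} (f : Fin k → ℕ) → sumF f ≡ sum f
sumF≡sum {zero}  f = refl
sumF≡sum {suc k} f = cong (f fzero +_) (sumF≡sum (f ∘ fsuc))

countF≡sum : ∀ {k} (f : Fin k → Bool) → countF f ≡ ∑[ i < k ] 𝟙 (f i)
countF≡sum {zero}  f = refl
countF≡sum {suc k} f = cong (𝟙 (f fzero) +_) (countF≡sum (f ∘ fsuc))

sum-zero : ∀ {k} {f : Fin k → ℕ} → (∀ i → f i ≡ 0) → sum f ≡ 0
sum-zero {k} f≡0 = trans (sum-cong-≗ f≡0) (sum-replicate-zero k)

sum-ones : ∀ k → ∑[ i < k ] 1 ≡ k
sum-ones zero    = refl
sum-ones (suc k) = cong suc (sum-ones k)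

sum-if : ∀ {k} (c : Bool) (f : Fin k → ℕ) →
         (if c then sum f else 0) ≡ ∑[ i < k ] (if c then f i else 0)
sum-if     true  f = refl
sum-if {k} false f = sym (sum-zero {k} λ _ → refl)

countF-pos : ∀ {k} (f : Fin k → Bool) (i : Fin k) → f i ≡ true → 1 ≤ countF f
countF-pos f fzero    fi rewrite fi = s≤s z≤n
countF-pos f (fsuc i) fi with f fzero
... | true  = s≤s z≤n
... | false = countF-pos (f ∘ fsuc) i fi

countF-false : ∀ {k} (f : Fin k → Bool) → (∀ i → f i ≡ false) → countF f ≡ 0
countF-false f f≡false = trans (countF≡sum f) (sum-zero (cong 𝟙 ∘ f≡false))

anyF-true : ∀ {k} (f : Fin k → Bool) (i : Fin k) → f i ≡ true → anyF f ≡ true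
anyF-true f fzero    fi rewrite fi = refl
anyF-true f (fsuc i) fi with f fzero
... | true  = refl
... | false = anyF-true (f ∘ fsuc) i fi

anyF-false : ∀ {k} (f : Fin k → Bool) → (∀ i → f i ≡ false) → anyF f ≡ false
anyF-false {zero}  f f≡false = refl
anyF-false {suc k} f f≡false rewrite f≡false fzero = anyF-false (f ∘ fsuc) (f≡false ∘ fsuc)

𝟙-anyF : ∀ {k} (f : Fin k → Bool) → (∀ i j → f i ≡ true → f j ≡ true → i ≡ j) →
         𝟙 (anyF f) ≡ ∑[ i < k ] 𝟙 (f i)
𝟙-anyF {zero}  f unique = refl
𝟙-anyF {suc k} f unique with f fzero in f₀
... | true  = cong suc (sym (sum-zero (cong 𝟙 ∘ others-false)))
  where
  others-false : ∀ i → f (fsuc i) ≡ false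
  others-false i = ¬-not λ fi → 0≢1+n (sym (unique (fsuc i) fzero fi f₀))
... | false = 𝟙-anyF (f ∘ fsuc) (λ i j fi fj → suc-injective (unique (fsuc i) (fsuc j) fi fj))

∃⟶∃-smallest : ∀ {k p} {P : Pred (Fin k) p} → Decidable P → ∃ P →
               ∃ λ i → P i × (∀ j → j <ᶠ i → ¬ P j)
∃⟶∃-smallest {k} {P = P} P? (i , Pi)
  with ¬∀⟶∃¬-smallest k (¬_ ∘ P) (¬? ∘ P?) (λ ∀¬P → ∀¬P i Pi)
... | v , ¬¬Pv , below = v , decidable-stable (P? v) ¬¬Pv , below′
  where
  below′ : ∀ j → j <ᶠ v → ¬ P j
  below′ j j<v = below (fromℕ< j<v) ∘ subst P (sym inject-fromℕ<)
    where
    inject-fromℕ< : inject (fromℕ< j<v) ≡ j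
    inject-fromℕ< = toℕ-injective (trans (toℕ-inject (fromℕ< j<v)) (toℕ-fromℕ< j<v))

eqMaybe⇒≡ : ∀ {k} {x : Maybe (Fin k)} {w : Fin k} → eqMaybe x w ≡ true → x ≡ just w
eqMaybe⇒≡ {x = just y} eq = cong just (toWitness (subst T (sym eq) tt))

≡⇒eqMaybe : ∀ {k} {x : Maybe (Fin k)} {w : Fin k} → x ≡ just w → eqMaybe x w ≡ true
≡⇒eqMaybe {w = w} refl with w ≟ w
... | yes _   = refl
... | no w≢w = ⊥-elim (w≢w refl)

sum-eqMaybe : ∀ {k} (c : Fin k → Bool) (x : Maybe (Fin k)) →
              ∑[ w < k ] (if c w then 𝟙 (eqMaybe x w) else 0) ≡ maybe′ (𝟙 ∘ c) 0 x
sum-eqMaybe c nothing = sum-zero (λ w → if-eta (c w))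
sum-eqMaybe {suc k} c (just fzero) =
  trans (cong (𝟙 (c fzero) +_) (sum-zero (λ w → if-eta (c (fsuc w))))) (+-identityʳ _)
sum-eqMaybe {suc k} c (just (fsuc y)) =
  cong₂ _+_ (if-eta (c fzero))
    (trans (sum-cong-≗ (λ w → cong (λ b → if c (fsuc w) then 𝟙 b else 0) (⌊⌋-map′ _ _ (y ≟ w))))
           (sum-eqMaybe (c ∘ fsuc) (just y)))

ones-++ : ∀ (xs ys : List Bool) → ones (xs ++ ys) ≡ ones xs + ones ys
ones-++ []           ys = refl
ones-++ (true  ∷ xs) ys = cong suc (ones-++ xs ys)
ones-++ (false ∷ xs) ys = ones-++ xs ys

ones-replicate-false : ∀ k → ones (replicate k false) ≡ 0
ones-replicate-false zero    = refl
ones-replicate-false (suc k) = ones-replicate-false k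

nth-++ʳ : ∀ {A : Set} (xs ys : List A) i → nth (xs ++ ys) (length xs + i) ≡ nth ys i
nth-++ʳ []       ys i = refl
nth-++ʳ (x ∷ xs) ys i = nth-++ʳ xs ys i

nth-++ˡ-head : ∀ {A : Set} (xs ys : List A) {a : A} → nth xs 0 ≡ just a → nth (xs ++ ys) 0 ≡ just a
nth-++ˡ-head (x ∷ xs) ys eq = eq

concatMap-filterᵇ-tabulate : ∀ {A B : Set} {k} (g : A → List B) (p : A → Bool) (f : Fin k → A) →
  concatMap g (filterᵇ p (tabulate f)) ≡ concat (tabulate (λ i → if p (f i) then g (f i) else []))
concatMap-filterᵇ-tabulate {k = zero}  g p f = refl
concatMap-filterᵇ-tabulate {k = suc k} g p f with p (f fzero)
... | true  = cong (g (f fzero) ++_) (concatMap-filterᵇ-tabulate g p (f ∘ fsuc))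
... | false = concatMap-filterᵇ-tabulate g p (f ∘ fsuc)

length-concat-tabulate : ∀ {A : Set} {k} (h : Fin k → List A) →
                         length (concat (tabulate h)) ≡ ∑[ i < k ] length (h i)
length-concat-tabulate {k = zero}  h = refl
length-concat-tabulate {k = suc k} h =
  trans (length-++ (h fzero)) (cong (length (h fzero) +_) (length-concat-tabulate (h ∘ fsuc)))

ones-concat-tabulate : ∀ {k} (h : Fin k → List Bool) →
                       ones (concat (tabulate h)) ≡ ∑[ i < k ] ones (h i)
ones-concat-tabulate {zero}  h = refl
ones-concat-tabulate {suc k} h =
  trans (ones-++ (h fzero) _) (cong (ones (h fzero) +_) (ones-concat-tabulate (h ∘ fsuc)))

nth-concat-tabulate : ∀ {A : Set} {k} (h : Fin k → List A) (i : Fin k) {a : A} → nth (h i) 0 ≡ just a →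
  nth (concat (tabulate h)) (∑[ j < k ] (if toℕ j <ᵇ toℕ i then length (h j) else 0)) ≡ just a
nth-concat-tabulate {k = suc k} h fzero {a} head =
  subst (λ t → nth (concat (tabulate h)) t ≡ just a) (sym (sum-replicate-zero k))
        (nth-++ˡ-head (h fzero) _ head)
nth-concat-tabulate {k = suc k} h (fsuc i) head =
  trans (nth-++ʳ (h fzero) _ _) (nth-concat-tabulate (h ∘ fsuc) i head)

NoParallelTransitions : ∀ {n σ} → Trans n σ → Set
NoParallelTransitions δ = ∀ u a a′ w → δ u a ≡ just w → δ u a′ ≡ just w → a ≡ a′

module _ {n σ : ℕ} (δ : Trans n σ) where

  transitionCount : (Fin n → Fin σ → Fin n → Bool) → ℕ
  transitionCount P = ∑[ u < n ] ∑[ a < σ ] maybe′ (λ w → 𝟙 (P u a w)) 0 (δ u a)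

  transitionCount-cong : ∀ P Q → (∀ u a w → δ u a ≡ just w → P u a w ≡ Q u a w) →
                         transitionCount P ≡ transitionCount Q
  transitionCount-cong P Q P≡Q = sum-cong-≗ λ u → sum-cong-≗ λ a → term u a
    where
    term : ∀ u a → maybe′ (λ w → 𝟙 (P u a w)) 0 (δ u a) ≡ maybe′ (λ w → 𝟙 (Q u a w)) 0 (δ u a)
    term u a with δ u a in eq
    ... | nothing = refl
    ... | just w  = cong 𝟙 (P≡Q u a w eq)

  numTrans≡transitionCount : numTrans δ ≡ transitionCount (λ _ _ _ → true)
  numTrans≡transitionCount =
    trans (sumF≡sum λ u → countF λ a → is-just (δ u a))
          (sum-cong-≗ λ u → trans (countF≡sum λ a → is-just (δ u a)) (sum-cong-≗ λ a → 𝟙-is-just (δ u a)))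
    where
    𝟙-is-just : (x : Maybe (Fin n)) → 𝟙 (is-just x) ≡ maybe′ (λ _ → 1) 0 x
    𝟙-is-just nothing  = refl
    𝟙-is-just (just _) = refl

  sumF-colNorm≡transitionCount : (c : Fin σ → Bool) →
    sumF (λ a → if c a then colNorm (rO δ) a else 0) ≡ transitionCount (λ _ a _ → c a)
  sumF-colNorm≡transitionCount c = begin
    sumF (λ a → if c a then colNorm (rO δ) a else 0)
      ≡⟨ sumF≡sum (λ a → if c a then colNorm (rO δ) a else 0) ⟩
    ∑[ a < σ ] (if c a then colNorm (rO δ) a else 0)
      ≡⟨ sum-cong-≗ (λ a → trans (cong (λ t → if c a then t else 0) (countF≡sum λ u → is-just (δ u a)))
                                 (sum-if (c a) λ u → 𝟙 (is-just (δ u a)))) ⟩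
    ∑[ a < σ ] ∑[ u < n ] (if c a then 𝟙 (is-just (δ u a)) else 0)
      ≡⟨ ∑-comm (λ a u → if c a then 𝟙 (is-just (δ u a)) else 0) ⟩
    ∑[ u < n ] ∑[ a < σ ] (if c a then 𝟙 (is-just (δ u a)) else 0)
      ≡⟨ sum-cong-≗ (λ u → sum-cong-≗ λ a → selected-is-just (c a) (δ u a)) ⟩
    transitionCount (λ _ a _ → c a) ∎
    where
    open ≡-Reasoning
    selected-is-just : (b : Bool) (x : Maybe (Fin n)) →
                       (if b then 𝟙 (is-just x) else 0) ≡ maybe′ (λ _ → 𝟙 b) 0 x
    selected-is-just b nothing  = if-eta b
    selected-is-just b (just _) = refl

  inDeg≡sum : NoParallelTransitions δ →
              ∀ w → inDeg δ w ≡ ∑[ u < n ] ∑[ a < σ ] 𝟙 (eqMaybe (δ u a) w)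
  inDeg≡sum noParallel w =
    trans (countF≡sum (λ u → anyF λ a → eqMaybe (δ u a) w))
          (sum-cong-≗ λ u → 𝟙-anyF (λ a → eqMaybe (δ u a) w)
                                   (λ a a′ p q → noParallel u a a′ w (eqMaybe⇒≡ p) (eqMaybe⇒≡ q)))

  sum-inDeg≡transitionCount : NoParallelTransitions δ → (c : Fin n → Bool) →
    ∑[ w < n ] (if c w then inDeg δ w else 0) ≡ transitionCount (λ _ _ w → c w)
  sum-inDeg≡transitionCount noParallel c = begin
    ∑[ w < n ] (if c w then inDeg δ w else 0)
      ≡⟨ sum-cong-≗ (λ w → trans (cong (λ t → if c w then t else 0) (inDeg≡sum noParallel w))
                          (trans (sum-if (c w) λ u → ∑[ a < σ ] 𝟙 (eqMaybe (δ u a) w))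
                                 (sum-cong-≗ λ u → sum-if (c w) λ a → 𝟙 (eqMaybe (δ u a) w)))) ⟩
    ∑[ w < n ] ∑[ u < n ] ∑[ a < σ ] hit u a w
      ≡⟨ ∑-comm (λ w u → ∑[ a < σ ] hit u a w) ⟩
    ∑[ u < n ] ∑[ w < n ] ∑[ a < σ ] hit u a w
      ≡⟨ sum-cong-≗ (λ u → ∑-comm (λ w a → hit u a w)) ⟩
    ∑[ u < n ] ∑[ a < σ ] ∑[ w < n ] hit u a w
      ≡⟨ sum-cong-≗ (λ u → sum-cong-≗ λ a → sum-eqMaybe c (δ u a)) ⟩
    transitionCount (λ _ _ w → c w) ∎
    where
    open ≡-Reasoning
    hit : Fin n → Fin σ → Fin n → ℕ
    hit u a w = if c w then 𝟙 (eqMaybe (δ u a) w) else 0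

block : ∀ {n σ} → Trans n σ → Fin n → List Bool
block δ v = if 0 <ᵇ toℕ v then true ∷ replicate (inDeg δ v ∸ 1) false else []

rI≡concat-block : ∀ {n σ} (δ : Trans n σ) → rI δ ≡ concat (tabulate (block δ))
rI≡concat-block δ =
  concatMap-filterᵇ-tabulate (λ v → true ∷ replicate (inDeg δ v ∸ 1) false) (λ v → 0 <ᵇ toℕ v) id

ones-rI : ∀ {n σ} (δ : Trans n σ) → ones (rI δ) ≡ n ∸ 1
ones-rI {n} δ = begin
  ones (rI δ)                          ≡⟨ cong ones (rI≡concat-block δ) ⟩
  ones (concat (tabulate (block δ)))   ≡⟨ ones-concat-tabulate (block δ) ⟩
  ∑[ v < n ] ones (block δ v)          ≡⟨ sum-cong-≗ ones-block ⟩
  ∑[ v < n ] 𝟙 (0 <ᵇ toℕ v)            ≡⟨ sum-nonSource n ⟩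
  n ∸ 1                                ∎
  where
  open ≡-Reasoning
  ones-block : ∀ v → ones (block δ v) ≡ 𝟙 (0 <ᵇ toℕ v)
  ones-block v with 0 <ᵇ toℕ v
  ... | true  = cong suc (ones-replicate-false (inDeg δ v ∸ 1))
  ... | false = refl
  sum-nonSource : ∀ k → ∑[ v < k ] 𝟙 (0 <ᵇ toℕ v) ≡ k ∸ 1
  sum-nonSource zero    = refl
  sum-nonSource (suc k) = sum-ones k

module _ {n m σ : ℕ} {δ : Trans n σ} (W : IsWDFA n m σ δ) where
  open IsWDFA W

  noParallel : NoParallelTransitions δ
  noParallel u a a′ w p q with <-cmp a a′
  ... | tri< a<a′ _ _ = ⊥-elim (<-irrefl refl (wheeler-i u u w w a a′ p q a<a′))
  ... | tri≈ _ a≡a′ _ = a≡a′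
  ... | tri> _ _ a′<a = ⊥-elim (<-irrefl refl (wheeler-i u u w w a′ a q p a′<a))

  length-block : ∀ v → length (block δ v) ≡ inDeg δ v
  length-block v with toℕ v in v≡
  ... | zero  = sym (countF-false _ λ u → anyF-false _ λ a →
                  ¬-not (proj₂ (incoming v) v≡ u a ∘ eqMaybe⇒≡))
  ... | suc _ with proj₁ (incoming v) (subst (0 <_) (sym v≡) (s≤s z≤n))
  ...   | u , a , δua≡v = trans (cong suc (length-replicate _))
                                (m+[n∸m]≡n (countF-pos _ u (anyF-true _ a (≡⇒eqMaybe δua≡v))))

  allTransitions≡m : transitionCount δ (λ _ _ _ → true) ≡ m
  allTransitions≡m = trans (sym (numTrans≡transitionCount δ)) transitions

  matNorm-rO : matNorm (rO δ) ≡ m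
  matNorm-rO = trans (sumF-colNorm≡transitionCount δ (λ _ → true)) allTransitions≡m

  colNorm-rO-pos : ∀ a → 1 ≤ colNorm (rO δ) a
  colNorm-rO-pos a with effective a
  ... | u , _ , δua≡v = countF-pos _ u (cong is-just δua≡v)

  length-rI : length (rI δ) ≡ m
  length-rI = begin
    length (rI δ)                          ≡⟨ cong length (rI≡concat-block δ) ⟩
    length (concat (tabulate (block δ)))   ≡⟨ length-concat-tabulate (block δ) ⟩
    ∑[ v < n ] length (block δ v)          ≡⟨ sum-cong-≗ length-block ⟩
    ∑[ v < n ] inDeg δ v                   ≡⟨ sum-inDeg≡transitionCount δ noParallel (λ _ → true) ⟩
    transitionCount δ (λ _ _ _ → true)     ≡⟨ allTransitions≡m ⟩
    m                                      ∎
    where open ≡-Reasoning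

  head-block : ∀ {u a v} → δ u a ≡ just v → nth (block δ v) 0 ≡ just true
  head-block {u} {a} {v} δua≡v with toℕ v in v≡
  ... | zero  = ⊥-elim (proj₂ (incoming v) v≡ u a δua≡v)
  ... | suc _ = refl

  smallest-target : ∀ j → ∃ λ v → (∃ λ u → δ u j ≡ just v) ×
                                   (∀ w → w <ᶠ v → ¬ ∃ λ u → δ u j ≡ just w)
  smallest-target j = ∃⟶∃-smallest (λ w → any? λ u → ≡-dec _≟_ (δ u j) (just w))
                                    (let u , v , δuj≡v = effective j in v , u , δuj≡v)

  module _ {j : Fin σ} {u₀ : Fin n} {v₀ : Fin n} (δu₀j≡v₀ : δ u₀ j ≡ just v₀)
           (smallest : ∀ w → w <ᶠ v₀ → ¬ ∃ λ u → δ u j ≡ just w) where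

    label<⇔target< : ∀ {u a w} → δ u a ≡ just w → (a <ᶠ j) ⇔ (w <ᶠ v₀)
    label<⇔target< {u} {a} {w} δua≡w =
      mk⇔ (wheeler-i u u₀ w v₀ a j δua≡w δu₀j≡v₀) target<⇒label<
      where
      target<⇒label< : w <ᶠ v₀ → a <ᶠ j
      target<⇒label< w<v₀ with <-cmp a j
      ... | tri< a<j _ _   = a<j
      ... | tri≈ _ refl _ = ⊥-elim (smallest w w<v₀ (u , δua≡w))
      ... | tri> _ _ j<a   =
        ⊥-elim (<-irrefl refl (<-trans w<v₀ (wheeler-i u₀ u v₀ w j a δu₀j≡v₀ δua≡w j<a)))

    colsBefore-rO :
      colsBefore (rO δ) j ≡ ∑[ w < n ] (if toℕ w <ᵇ toℕ v₀ then length (block δ w) else 0)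
    colsBefore-rO = begin
      colsBefore (rO δ) j
        ≡⟨ sumF-colNorm≡transitionCount δ (λ a → toℕ a <ᵇ toℕ j) ⟩
      transitionCount δ (λ _ a _ → toℕ a <ᵇ toℕ j)
        ≡⟨ transitionCount-cong δ _ _ (λ u a w δua≡w →
             does-⇔ (label<⇔target< δua≡w) (toℕ a <? toℕ j) (toℕ w <? toℕ v₀)) ⟩
      transitionCount δ (λ _ _ w → toℕ w <ᵇ toℕ v₀)
        ≡⟨ sum-inDeg≡transitionCount δ noParallel (λ w → toℕ w <ᵇ toℕ v₀) ⟨
      ∑[ w < n ] (if toℕ w <ᵇ toℕ v₀ then inDeg δ w else 0)
        ≡⟨ sum-cong-≗ (λ w → cong (λ t → if toℕ w <ᵇ toℕ v₀ then t else 0) (length-block w)) ⟨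
      ∑[ w < n ] (if toℕ w <ᵇ toℕ v₀ then length (block δ w) else 0) ∎
      where open ≡-Reasoning

  nth-rI-colsBefore : ∀ j → nth (rI δ) (colsBefore (rO δ) j) ≡ just true
  nth-rI-colsBefore j with smallest-target j
  ... | v₀ , (u₀ , δu₀j≡v₀) , smallest = begin
    nth (rI δ) (colsBefore (rO δ) j)
      ≡⟨ cong₂ nth (rI≡concat-block δ) (colsBefore-rO δu₀j≡v₀ smallest) ⟩
    nth (concat (tabulate (block δ))) (∑[ w < n ] (if toℕ w <ᵇ toℕ v₀ then length (block δ w) else 0))
      ≡⟨ nth-concat-tabulate (block δ) v₀ (head-block δu₀j≡v₀) ⟩
    just true ∎
    where open ≡-Reasoning

lemma11 : ∀ (n m σ : ℕ) → 1 ≤ n → n ∸ 1 ≤ m → m ≤ n * σ → σ ≤ n ∸ 1 →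
          (δ : Trans n σ) → IsWDFA n m σ δ →
          InR n m σ (rO δ) (rI δ)
lemma11 n m σ _ _ _ _ δ W =
  (matNorm-rO W , colNorm-rO-pos W) , ((length-rI W , ones-rI δ) , nth-rI-colsBefore W)
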